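{- Let $k$ be a nonnegative integer. For every integer $g$ with $0 \le g \le k$, the games $T_k$ and $W_1$ have the same set of positions with nim-value $g$. In particular, if $k$ and $l$ are nonnegative integers, then for every integer $g$ with $0 \le g \le \min(k,l)$, the games $T_k$ and $T_l$ have the same set of positions with nim-value $g$.
   Context: Positions are pairs $(a,b)$ of nonnegative integers; games are impartial with normal play (the last player able to move wins). In the game $W_1$, from $(a,b)$ one may make a Nim move to $(a-s,b)$ or $(a,b-s)$ for any integer $s>0$ keeping coordinates nonnegative, or a diagonal move to $(a-s,b-s)$ with $s>0$ provided $\min(a-s,b-s) \ge 1$. For an integer $k \ge 0$, the game $T_k$ allows all the same Nim moves, and restricts the diagonal moves of $W_1$ as follows: if $a \le b$, a diagonal move from $(a,b)$ to $(a-s,b-s)$ with $s>0$ and $a-s>0$ is allowed if and only if $\left| \left\lfloor \frac{b-s}{a-s} \right\rfloor - \left\lfloor \frac{b}{a} \right\rfloor \right| \le k$; symmetrically, if $a > b$, a diagonal move to $(a-s,b-s)$ with $b-s>0$ is allowed if and only if $\left| \left\lfloor \frac{a-s}{b-s} \right\rfloor - \left\lfloor \frac{a}{b} \right\rfloor \right| \le k$. The nim-value (Sprague–Grundy value) of a position is the minimum excluded nonnegative integer of the set of nim-values of positions reachable in one move (terminal positions have nim-value $0$). -}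

module Defs where

open import Data.Nat using (ℕ; zero; suc; _+_; _∸_; _≤ᵇ_; _≡ᵇ_; _⊔_; _⊓_; ∣_-_∣; _/_)
open import Data.Bool using (Bool; true; false; if_then_else_; _∨_)
open import Data.List using (List; []; _∷_; map; length; upTo; filter; _++_)
open import Data.Product using (_×_; _,_)

Pos : Set
Pos = ℕ × ℕ

Game : Set
Game = Pos → List Pos

elem : ℕ → List ℕ → Bool
elem n []       = false
elem n (x ∷ xs) = (n ≡ᵇ x) ∨ elem n xs

mexFrom : ℕ → ℕ → List ℕ → ℕ
mexFrom zero    n xs = n
mexFrom (suc f) n xs = if elem n xs then mexFrom f (suc n) xs else n

-- mex xs = least natural number not occurring in xs
-- (it is at most length xs, so length xs + 1 steps of fuel suffice)
mex : List ℕ → ℕ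
mex xs = mexFrom (suc (length xs)) 0 xs

-- Sprague–Grundy value.  Every move in the games below strictly decreases
-- a + b, so recursion with fuel a + b computes the true nim-value.

nvFuel : Game → ℕ → Pos → ℕ
nvFuel G zero    p = 0
nvFuel G (suc n) p = mex (map (nvFuel G n) (G p))

nimValue : Game → ℕ → ℕ → ℕ
nimValue G a b = nvFuel G (a + b) (a , b)

nimMoves : Pos → List Pos
nimMoves (a , b) = map (λ i → (i , b)) (upTo a) ++ map (λ j → (a , j)) (upTo b)

-- the values s with s > 0 and min(a - s , b - s) ≥ 1, i.e. 1 ≤ s ≤ min a b - 1
diagSteps : Pos → List ℕ
diagSteps (a , b) = map suc (upTo ((a ⊓ b) ∸ 1))

diagTarget : Pos → ℕ → Pos
diagTarget (a , b) s = (a ∸ s , b ∸ s)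

W₁ : Game
W₁ p = nimMoves p ++ map (diagTarget p) (diagSteps p)

-- floor division, only used with nonzero divisor
quot : ℕ → ℕ → ℕ
quot x zero    = 0
quot x (suc y) = x / suc y

ratio : Pos → ℕ
ratio (a , b) = quot (a ⊔ b) (a ⊓ b)

allowedT : ℕ → Pos → ℕ → Bool
allowedT k p s = ∣ ratio (diagTarget p s) - ratio p ∣ ≤ᵇ k

filterB : {A : Set} → (A → Bool) → List A → List A
filterB f []       = []
filterB f (x ∷ xs) = if f x then x ∷ filterB f xs else filterB f xs

T : ℕ → Game
T k p = nimMoves p ++ map (diagTarget p) (filterB (allowedT k p) (diagSteps p))

module Submission where

-- T_k is W₁ with some diagonal moves removed.  The proof rests on a general
-- comparison principle (module Agreement): if every H-move is a G-move and every
-- G-move missing from H leads to a position of G-value > k, then G and H have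
-- the same positions of each value g ≤ k.  It is proved by induction on a + b
-- from the mex characterisation of nim-values.  It thus suffices to show that a
-- diagonal move forbidden in T_k lands on a W₁-position of value > k.  This
-- combines two facts:
--   * the lower bound  max(x,y) < W₁(x,y) + 2·min(x,y)  for min(x,y) ≥ 1,
--     proved by an injective labelling of the positions (c , j), j < d, with
--     numbers below W₁(c,d) + 2c − 1;
--   * a diagonal move never decreases ⌊max/min⌋, so a forbidden move reaches a
--     position with max ≥ (k + 2)·min, whose W₁-value must then exceed k.

open import Defs
open import Data.Nat using (ℕ; _≤_)
open import Data.Product using (_×_)
open import Relation.Binary.PropositionalEquality using (_≡_)
open import Function.Bundles using (_⇔_)

open import Data.Nat using (zero; suc; _+_; _∸_; _*_; _<_; _⊔_; _⊓_; _≡ᵇ_; _/_; z≤n; s≤s; ∣_-_∣)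
open import Data.Nat.Properties
open import Data.Nat.DivMod using (m/n*n≤m; m*n/n≡m; /-monoˡ-≤)
open import Data.Nat.Induction using (<-wellFounded)
open import Data.Bool using (Bool; true; false) renaming (T to IsTrue)
open import Data.Unit using (tt)
open import Data.List using (List; []; _∷_; map; length; upTo)
open import Data.List.Properties using (map-cong-local)
open import Data.List.Relation.Unary.All using (tabulate)
open import Data.List.Relation.Binary.Subset.Propositional using (_⊆_)
import Data.List.Relation.Binary.Subset.Propositional.Properties as ⊆
open import Data.List.Relation.Unary.Any using (here; there)
open import Data.List.Membership.Propositional using (_∈_; _∉_)
open import Data.List.Membership.Propositional.Properties
  using (∈-map⁺; ∈-map⁻; ∈-++⁺ˡ; ∈-++⁺ʳ; ∈-++⁻; ∈-upTo⁺; ∈-upTo⁻)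
open import Data.List.Membership.Setoid.Properties using (index-injective)
open import Data.Product using (∃-syntax; _,_; proj₁; proj₂; swap)
open import Data.Sum using (_⊎_; inj₁; inj₂)
open import Data.Empty using (⊥-elim)
open import Relation.Nullary using (¬_)
open import Relation.Binary using (tri<; tri≈; tri>)
open import Relation.Binary.PropositionalEquality
  using (refl; sym; trans; cong; subst; subst₂; _≢_; setoid; module ≡-Reasoning)
open import Data.Fin using (Fin; toℕ; fromℕ<)
open import Data.Fin.Properties using (toℕ<n; toℕ-fromℕ<; toℕ-injective; injective⇒≤)
open import Function.Bundles using (mk⇔; Equivalence)
open import Function.Construct.Composition using (_⇔-∘_)
open import Function.Construct.Symmetry using (⇔-sym)
open import Induction.WellFounded using (module All)
import Relation.Binary.Construct.On as On
open import Level using (0ℓ)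

elem-sound : ∀ n xs → elem n xs ≡ true → n ∈ xs
elem-sound n (x ∷ xs) e with n ≡ᵇ x in eq
... | true  = here (≡ᵇ⇒≡ n x (subst IsTrue (sym eq) tt))
... | false = there (elem-sound n xs e)

elem-complete : ∀ n xs → n ∈ xs → elem n xs ≡ true
elem-complete n (x ∷ xs) n∈ with n ≡ᵇ x in eq | n∈
... | true  | _        = refl
... | false | here n≡x = ⊥-elim (subst IsTrue eq (≡⇒≡ᵇ n x n≡x))
... | false | there n∈xs = elem-complete n xs n∈xs

range⊆⇒≤length : ∀ n xs → (∀ h → h < n → h ∈ xs) → n ≤ length xs
range⊆⇒≤length n xs range⊆ =
  injective⇒≤ (λ eq → toℕ-injective (index-injective (setoid ℕ) (position _) (position _) eq))
  where
  position : (i : Fin n) → toℕ i ∈ xs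
  position i = range⊆ (toℕ i) (toℕ<n i)

record IsMex (xs : List ℕ) (v : ℕ) : Set where
  field
    missing : v ∉ xs
    below   : ∀ h → h < v → h ∈ xs

mexFrom-isMex : ∀ f n xs → f + n ≡ suc (length xs) → (∀ h → h < n → h ∈ xs)
              → IsMex xs (mexFrom f n xs)
mexFrom-isMex zero n xs f+n≡ below =
  ⊥-elim (<-irrefl refl (subst (_≤ length xs) f+n≡ (range⊆⇒≤length n xs below)))
mexFrom-isMex (suc f) n xs f+n≡ below with elem n xs in eq
... | true  = mexFrom-isMex f (suc n) xs (trans (+-suc f n) f+n≡) below′
  where
  below′ : ∀ h → h < suc n → h ∈ xs
  below′ h (s≤s h≤n) with m≤n⇒m<n∨m≡n h≤n
  ... | inj₁ h<n  = below h h<n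
  ... | inj₂ refl = elem-sound h xs eq
... | false = record { missing = λ n∈ → subst IsTrue (trans (sym (elem-complete n xs n∈)) eq) tt
                     ; below   = below }

mex-isMex : ∀ xs → IsMex xs (mex xs)
mex-isMex xs = mexFrom-isMex (suc (length xs)) 0 xs (+-identityʳ _) (λ h ())

IsMex-unique : ∀ {xs v w} → IsMex xs v → IsMex xs w → v ≡ w
IsMex-unique {v = v} {w} mv mw with <-cmp v w
... | tri< v<w _ _ = ⊥-elim (IsMex.missing mv (IsMex.below mw v v<w))
... | tri≈ _ v≡w _ = v≡w
... | tri> _ _ w<v = ⊥-elim (IsMex.missing mw (IsMex.below mv w w<v))

size : Pos → ℕ
size (a , b) = a + b

val : Game → Pos → ℕ
val G p = nvFuel G (size p) p

Decreasing : Game → Set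
Decreasing G = ∀ p q → q ∈ G p → size q < size p

size-rec : (P : Pos → Set) → (∀ p → (∀ {q} → size q < size p → P q) → P p) → ∀ p → P p
size-rec = All.wfRec (On.wellFounded size <-wellFounded) 0ℓ

module NimValue (G : Game) (decreasing : Decreasing G) where

  -- (0 , 0) is terminal, which makes the zero-fuel case of nvFuel correct.
  no-options-at-origin : ∀ p → size p ≡ 0 → G p ≡ []
  no-options-at-origin p size≡0 with G p in eq
  ... | []    = refl
  ... | q ∷ _ = ⊥-elim (n≮0 (subst (size q <_) size≡0
                                     (decreasing p q (subst (q ∈_) (sym eq) (here refl)))))

  nvFuel-stable : ∀ n m p → size p ≤ n → size p ≤ m → nvFuel G n p ≡ nvFuel G m p
  nvFuel-stable zero    zero    p _  _  = refl
  nvFuel-stable zero    (suc m) p ≤0 _  rewrite no-options-at-origin p (n≤0⇒n≡0 ≤0) = refl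
  nvFuel-stable (suc n) zero    p _  ≤0 rewrite no-options-at-origin p (n≤0⇒n≡0 ≤0) = refl
  nvFuel-stable (suc n) (suc m) p ≤n ≤m = cong mex (map-cong-local (tabulate λ {q} q∈ →
    let q<p = decreasing p q q∈ in
    nvFuel-stable n m q (≤-pred (≤-trans q<p ≤n)) (≤-pred (≤-trans q<p ≤m))))

  val-unfold : ∀ p → val G p ≡ mex (map (val G) (G p))
  val-unfold p with size p in eq
  ... | zero  rewrite no-options-at-origin p eq = refl
  ... | suc n = cong mex (map-cong-local (tabulate λ {q} q∈ →
    nvFuel-stable n (size q) q (≤-pred (subst (size q <_) eq (decreasing p q q∈))) ≤-refl))

  record IsValue (p : Pos) (g : ℕ) : Set where
    field
      missing : ∀ q → q ∈ G p → val G q ≢ g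
      below   : ∀ h → h < g → ∃[ q ] q ∈ G p × val G q ≡ h

  val-isValue : ∀ p → IsValue p (val G p)
  val-isValue p = record
    { missing = λ q q∈ eq → IsMex.missing isMex (subst (_∈ values) eq (∈-map⁺ (val G) q∈))
    ; below   = λ h h< → let (q , q∈ , eq) = ∈-map⁻ (val G) (IsMex.below isMex h h<)
                         in q , q∈ , sym eq }
    where
    values : List ℕ
    values = map (val G) (G p)
    isMex : IsMex values (val G p)
    isMex = subst (IsMex values) (sym (val-unfold p)) (mex-isMex values)

  isValue⇒val : ∀ {p g} → IsValue p g → val G p ≡ g
  isValue⇒val {p} {g} isV = trans (val-unfold p) (IsMex-unique (mex-isMex _) isMex)
    where
    open IsValue isV
    isMex : IsMex (map (val G) (G p)) g
    isMex = record
      { missing = λ g∈ → let (q , q∈ , eq) = ∈-map⁻ (val G) g∈ in missing q q∈ (sym eq)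
      ; below   = λ h h< → let (q , q∈ , eq) = below h h<
                           in subst (_∈ map (val G) (G p)) eq (∈-map⁺ (val G) q∈) }

  swap-invariant : (∀ p q → q ∈ G p → swap q ∈ G (swap p)) → ∀ p → val G (swap p) ≡ val G p
  swap-invariant G-swap = size-rec _ λ p ih → isValue⇒val (record
    { missing = λ q q∈ eq → IsValue.missing (val-isValue p) (swap q) (G-swap (swap p) q q∈)
                              (trans (sym (ih {swap q} (size-swap q∈))) eq)
    ; below   = λ h h< → let (q , q∈ , eq) = IsValue.below (val-isValue p) h h<
                         in swap q , G-swap p q q∈ , trans (ih {q} (decreasing p q q∈)) eq })
    where
    size-swap : ∀ {p q} → q ∈ G (swap p) → size (swap q) < size p
    size-swap {a , b} {x , y} q∈ = subst₂ _<_ (+-comm x y) (+-comm b a) (decreasing (b , a) (x , y) q∈)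

module Agreement (G H : Game) (G-decreasing : Decreasing G)
                 (H⊆G : ∀ p → H p ⊆ G p)
                 (k : ℕ) (escape : ∀ p q → q ∈ G p → q ∈ H p ⊎ k < val G q) where

  private
    H-decreasing : Decreasing H
    H-decreasing p q q∈ = G-decreasing p q (H⊆G p q∈)

    module VG = NimValue G G-decreasing
    module VH = NimValue H H-decreasing

  Agree : Pos → Set
  Agree p = ∀ g → g ≤ k → (val H p ≡ g) ⇔ (val G p ≡ g)

  agree : ∀ p → Agree p
  agree = size-rec Agree step
    where
    step : ∀ p → (∀ {q} → size q < size p → Agree q) → Agree p
    step p ih g g≤k = mk⇔ H⇒G G⇒H
      where
      open Equivalence
      ih′ : ∀ {q} → q ∈ G p → Agree q
      ih′ {q} q∈ = ih {q} (G-decreasing p q q∈)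

      -- below g both games take values h < g ≤ k, where the induction applies
      h≤k : ∀ {h} → h < g → h ≤ k
      h≤k h<g = <⇒≤ (<-≤-trans h<g g≤k)

      H⇒G : val H p ≡ g → val G p ≡ g
      H⇒G refl = VG.isValue⇒val record { missing = missing ; below = below }
        where
        missing : ∀ q → q ∈ G p → val G q ≢ val H p
        missing q q∈ eq with escape p q q∈
        ... | inj₁ q∈H = VH.IsValue.missing (VH.val-isValue p) q q∈H (from (ih′ q∈ _ g≤k) eq)
        ... | inj₂ k<v = <⇒≱ k<v (subst (_≤ k) (sym eq) g≤k)
        below : ∀ h → h < val H p → ∃[ q ] q ∈ G p × val G q ≡ h
        below h h<g with VH.IsValue.below (VH.val-isValue p) h h<g
        ... | q , q∈H , eq = q , H⊆G p q∈H , to (ih′ (H⊆G p q∈H) h (h≤k h<g)) eq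

      G⇒H : val G p ≡ g → val H p ≡ g
      G⇒H refl = VH.isValue⇒val record { missing = missing ; below = below }
        where
        missing : ∀ q → q ∈ H p → val H q ≢ val G p
        missing q q∈H eq = VG.IsValue.missing (VG.val-isValue p) q (H⊆G p q∈H)
                             (to (ih′ (H⊆G p q∈H) _ g≤k) eq)
        below : ∀ h → h < val G p → ∃[ q ] q ∈ H p × val H q ≡ h
        below h h<g with VG.IsValue.below (VG.val-isValue p) h h<g
        ... | q , q∈ , eq with escape p q q∈
        ...   | inj₁ q∈H = q , q∈H , from (ih′ q∈ h (h≤k h<g)) eq
        ...   | inj₂ k<v = ⊥-elim (<⇒≱ (<-trans (subst (k <_) eq k<v) h<g) g≤k)

data W₁-Move (a b : ℕ) : Pos → Set where
  left : ∀ i → i < a → W₁-Move a b (i , b)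
  down : ∀ j → j < b → W₁-Move a b (a , j)
  diag : ∀ t → suc t < a → suc t < b → W₁-Move a b (a ∸ suc t , b ∸ suc t)

∈-diagSteps⁻ : ∀ {a b s} → s ∈ diagSteps (a , b) → s < a ⊓ b
∈-diagSteps⁻ {a} {b} s∈ with ∈-map⁻ suc s∈
... | t , t∈ , refl with a ⊓ b | ∈-upTo⁻ t∈
...   | suc _ | t<m = s≤s t<m

∈-diagSteps⁺ : ∀ {a b t} → suc t < a ⊓ b → suc t ∈ diagSteps (a , b)
∈-diagSteps⁺ {a} {b} st< with a ⊓ b | st<
... | suc _ | s≤s t< = ∈-map⁺ suc (∈-upTo⁺ t<)

W₁-move⁻ : ∀ {a b q} → q ∈ W₁ (a , b) → W₁-Move a b q
W₁-move⁻ {a} {b} q∈ with ∈-++⁻ (nimMoves (a , b)) q∈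
... | inj₁ q∈nim with ∈-++⁻ (map (λ i → (i , b)) (upTo a)) q∈nim
...   | inj₁ q∈left with ∈-map⁻ (λ i → (i , b)) q∈left
...     | i , i∈ , refl = left i (∈-upTo⁻ i∈)
W₁-move⁻ {a} {b} q∈ | inj₁ q∈nim | inj₂ q∈down with ∈-map⁻ (λ j → (a , j)) q∈down
...     | j , j∈ , refl = down j (∈-upTo⁻ j∈)
W₁-move⁻ {a} {b} q∈ | inj₂ q∈diag with ∈-map⁻ (diagTarget (a , b)) q∈diag
... | s , s∈ , refl with ∈-map⁻ suc s∈
...   | t , _ , refl = diag t (m<n⊓o⇒m<n a b st<) (m<n⊓o⇒m<o a b st<)
  where
  st< : suc t < a ⊓ b
  st< = ∈-diagSteps⁻ s∈

W₁-move⁺ : ∀ {a b q} → W₁-Move a b q → q ∈ W₁ (a , b)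
W₁-move⁺ {a} {b} (left i i<a) =
  ∈-++⁺ˡ (∈-++⁺ˡ (∈-map⁺ (λ i → (i , b)) (∈-upTo⁺ i<a)))
W₁-move⁺ {a} {b} (down j j<b) =
  ∈-++⁺ˡ (∈-++⁺ʳ (map (λ i → (i , b)) (upTo a)) (∈-map⁺ (λ j → (a , j)) (∈-upTo⁺ j<b)))
W₁-move⁺ {a} {b} (diag t ta tb) =
  ∈-++⁺ʳ (nimMoves (a , b)) (∈-map⁺ (diagTarget (a , b)) (∈-diagSteps⁺ (⊓-pres-m< ta tb)))

W₁-decreasing : Decreasing W₁
W₁-decreasing (a , b) q q∈ with W₁-move⁻ {a} {b} q∈
... | left i i<a   = +-monoˡ-< b i<a
... | down j j<b   = +-monoʳ-< a j<b
... | diag t ta tb = +-mono-<-≤ (∸-monoʳ-< (s≤s z≤n) (<⇒≤ ta)) (m∸n≤m b (suc t))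

W₁-swap : ∀ p q → q ∈ W₁ p → swap q ∈ W₁ (swap p)
W₁-swap (a , b) q q∈ with W₁-move⁻ {a} {b} q∈
... | left i i<a   = W₁-move⁺ (down i i<a)
... | down j j<b   = W₁-move⁺ (left j j<b)
... | diag t ta tb = W₁-move⁺ (diag t tb ta)

module VW = NimValue W₁ W₁-decreasing

W₁-symmetric : ∀ a b → val W₁ (b , a) ≡ val W₁ (a , b)
W₁-symmetric a b = VW.swap-invariant W₁-swap (a , b)

W₁-option-value : ∀ {a b q} → W₁-Move a b q → val W₁ q ≢ val W₁ (a , b)
W₁-option-value {a} {b} {q} m = VW.IsValue.missing (VW.val-isValue (a , b)) q (W₁-move⁺ m)

-- Values along a column are pairwise distinct (Nim moves along the column).
W₁-column-injective : ∀ x {y y'} → val W₁ (x , y) ≡ val W₁ (x , y') → y ≡ y'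
W₁-column-injective x {y} {y'} eq with <-cmp y y'
... | tri< y<y' _ _ = ⊥-elim (W₁-option-value {x} (down y y<y') eq)
... | tri≈ _ y≡y' _ = y≡y'
... | tri> _ _ y'<y = ⊥-elim (W₁-option-value {x} (down y' y'<y) (sym eq))

labelling-bound : ∀ {d m} (Label : ℕ → ℕ → Set)
                → (∀ j → j < d → ∃[ e ] e < m × Label j e)
                → (∀ {j j' e} → Label j e → Label j' e → j ≡ j')
                → d ≤ m
labelling-bound {d} {m} Label label unique = injective⇒≤ {f = code} code-injective
  where
  code : Fin d → Fin m
  code i = fromℕ< (proj₁ (proj₂ (label (toℕ i) (toℕ<n i))))

  code-injective : ∀ {i i'} → code i ≡ code i' → i ≡ i'
  code-injective {i} {i'} eq = toℕ-injective (unique (subst (Label (toℕ i)) same-label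
                                                        (proj₂ (proj₂ (label (toℕ i) _))))
                                                      (proj₂ (proj₂ (label (toℕ i') _))))
    where
    same-label : proj₁ (label (toℕ i) _) ≡ proj₁ (label (toℕ i') _)
    same-label = trans (sym (toℕ-fromℕ< _)) (trans (cong toℕ eq) (toℕ-fromℕ< _))

-- Every j < d gets a label
-- e < v + 2c − 1 from which j can be recovered:
--   e = W₁(c , j)     if this value is < v;
-- otherwise W₁(c , j) > v (it is ≠ v, as (c , j) is an option of (c , d)), so
-- (c , j) has an option of value v, which cannot lie in column c:
--   e = v + i         if that option is (i , j) with i < c,
--   e = v + c + t     if it is (c − 1 − t , j − 1 − t) with t + 1 < c.
module ColumnBound (c′ d : ℕ) where
  c : ℕ
  c = suc c′

  v : ℕ
  v = val W₁ (c , d)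

  data Label (j e : ℕ) : Set where
    low : e < v → val W₁ (c , j) ≡ e → Label j e
    row : ∀ i → i < c → e ≡ v + i → val W₁ (i , j) ≡ v → Label j e
    dia : ∀ t → suc t < j → e ≡ v + c + t → val W₁ (c ∸ suc t , j ∸ suc t) ≡ v → Label j e

  label : ∀ j → j < d → ∃[ e ] e < v + c + c′ × Label j e
  label j j<d with <-cmp (val W₁ (c , j)) v
  ... | tri< w<v _ _ = _ , <-≤-trans w<v (≤-trans (m≤m+n v c) (m≤m+n (v + c) c′)) , low w<v refl
  ... | tri≈ _ w≡v _ = ⊥-elim (W₁-option-value {c} (down j j<d) w≡v)
  ... | tri> _ _ v<w with VW.IsValue.below (VW.val-isValue (c , j)) v v<w
  ...   | q , q∈ , q≡v with W₁-move⁻ {c} {j} q∈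
  ...     | left i i<c = _ , <-≤-trans (+-monoʳ-< v i<c) (m≤m+n (v + c) c′) , row i i<c refl q≡v
  ...     | down j′ j′<j = ⊥-elim (W₁-option-value {c} (down j′ (<-trans j′<j j<d)) q≡v)
  ...     | diag t (s≤s t<c′) t<j = _ , +-monoʳ-< (v + c) t<c′ , dia t t<j refl q≡v

  -- The three kinds of labels occupy the disjoint ranges [0 , v), [v , v + c)
  -- and [v + c , ∞).
  low≢high : ∀ {e} x → e < v → e ≢ v + x
  low≢high x e<v refl = <⇒≱ e<v (m≤m+n v x)

  row≢dia : ∀ {i t} → i < c → v + i ≢ v + c + t
  row≢dia {i} {t} i<c eq =
    <⇒≱ i<c (subst (c ≤_) (sym (+-cancelˡ-≡ v i (c + t) (trans eq (+-assoc v c t)))) (m≤m+n c t))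

  label-unique : ∀ {j j' e} → Label j e → Label j' e → j ≡ j'
  label-unique (low _ w≡e) (low _ w′≡e) = W₁-column-injective c (trans w≡e (sym w′≡e))
  label-unique (low e<v _) (row i _ e≡ _) = ⊥-elim (low≢high i e<v e≡)
  label-unique (low e<v _) (dia t _ e≡ _) = ⊥-elim (low≢high (c + t) e<v (trans e≡ (+-assoc v c t)))
  label-unique (row i _ e≡ _) (low e<v _) = ⊥-elim (low≢high i e<v e≡)
  label-unique (dia t _ e≡ _) (low e<v _) = ⊥-elim (low≢high (c + t) e<v (trans e≡ (+-assoc v c t)))
  label-unique (row i i<c refl _) (dia t _ e≡ _) = ⊥-elim (row≢dia i<c e≡)
  label-unique (dia t _ refl _) (row i i<c e≡ _) = ⊥-elim (row≢dia i<c (sym e≡))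
  label-unique (row i _ refl w≡v) (row i′ _ e≡ w′≡v) with +-cancelˡ-≡ v i i′ e≡
  ... | refl = W₁-column-injective i (trans w≡v (sym w′≡v))
  label-unique (dia t t<j refl w≡v) (dia t′ t′<j′ e≡ w′≡v) with +-cancelˡ-≡ (v + c) t t′ e≡
  ... | refl = ∸-cancelʳ-≡ (<⇒≤ t<j) (<⇒≤ t′<j′)
                 (W₁-column-injective (c ∸ suc t) (trans w≡v (sym w′≡v)))

  column-bound : d < v + 2 * c
  column-bound = subst (d <_) size-eq (s≤s (labelling-bound Label label label-unique))
    where
    open ≡-Reasoning
    size-eq : suc (v + c + c′) ≡ v + 2 * c
    size-eq = begin
      suc (v + c + c′) ≡⟨ sym (+-suc (v + c) c′) ⟩
      v + c + c        ≡⟨ +-assoc v c c ⟩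
      v + (c + c)      ≡⟨ cong (λ z → v + (c + z)) (sym (+-identityʳ c)) ⟩
      v + 2 * c        ∎

W₁-lower-bound : ∀ x y → 1 ≤ x ⊓ y → x ⊔ y < val W₁ (x , y) + 2 * (x ⊓ y)
W₁-lower-bound (suc x) (suc y) _ with ≤-total x y
... | inj₁ x≤y = subst₂ (λ M m → M < val W₁ (suc x , suc y) + 2 * m)
                   (sym (m≤n⇒m⊔n≡n (s≤s x≤y))) (sym (m≤n⇒m⊓n≡m (s≤s x≤y)))
                   (ColumnBound.column-bound x (suc y))
... | inj₂ y≤x = subst₂ (λ M m → M < val W₁ (suc x , suc y) + 2 * m)
                   (sym (m≥n⇒m⊔n≡m (s≤s y≤x))) (sym (m≥n⇒m⊓n≡n (s≤s y≤x)))
                   (subst (λ w → suc x < w + 2 * suc y) (W₁-symmetric (suc x) (suc y))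
                      (ColumnBound.column-bound y (suc x)))

quot-*≤ : ∀ x y → 1 ≤ y → quot x y * y ≤ x
quot-*≤ x (suc y) _ = m/n*n≤m x (suc y)

quot-≥ : ∀ z x y → 1 ≤ y → z * y ≤ x → z ≤ quot x y
quot-≥ z x (suc y) _ z*y≤x = subst (_≤ x / suc y) (m*n/n≡m z (suc y)) (/-monoˡ-≤ (suc y) z*y≤x)

quot-≥1 : ∀ M m → 1 ≤ m → m ≤ M → 1 ≤ quot M m
quot-≥1 M m 1≤m m≤M = quot-≥ 1 M m 1≤m (subst (_≤ M) (sym (*-identityˡ m)) m≤M)

-- Subtracting s < m from both M ≥ m and m does not decrease ⌊M/m⌋:
-- with r = ⌊M/m⌋ ≥ 1 we get r·(m − s) = r·m − r·s ≤ M − s.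
quot-diag-mono : ∀ M m s → s < m → m ≤ M → quot M m ≤ quot (M ∸ s) (m ∸ s)
quot-diag-mono M m s s<m m≤M = quot-≥ r (M ∸ s) (m ∸ s) (m<n⇒0<n∸m s<m) (begin
  r * (m ∸ s)     ≡⟨ *-distribˡ-∸ r m s ⟩
  r * m ∸ r * s   ≤⟨ ∸-monoˡ-≤ (r * s) (quot-*≤ M m 1≤m) ⟩
  M ∸ r * s       ≤⟨ ∸-monoʳ-≤ M (subst (_≤ r * s) (*-identityˡ s) (*-monoˡ-≤ s 1≤r)) ⟩
  M ∸ s           ∎)
  where
  open ≤-Reasoning
  r : ℕ
  r = quot M m
  1≤m : 1 ≤ m
  1≤m = ≤-trans (s≤s z≤n) s<m
  1≤r : 1 ≤ r
  1≤r = quot-≥1 M m 1≤m m≤M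

ratio-jump : ∀ k M m s → s < m → m ≤ M
           → ¬ (∣ quot (M ∸ s) (m ∸ s) - quot M m ∣ ≤ k)
           → (2 + k) * (m ∸ s) ≤ M ∸ s
ratio-jump k M m s s<m m≤M jump =
  ≤-trans (*-monoˡ-≤ (m ∸ s) 2+k≤r′) (quot-*≤ (M ∸ s) (m ∸ s) (m<n⇒0<n∸m s<m))
  where
  r r′ : ℕ
  r  = quot M m
  r′ = quot (M ∸ s) (m ∸ s)
  r≤r′ : r ≤ r′
  r≤r′ = quot-diag-mono M m s s<m m≤M
  k<r′∸r : k < r′ ∸ r
  k<r′∸r = ≰⇒> (λ r′∸r≤k → jump (subst (_≤ k) (sym (m≤n⇒∣n-m∣≡n∸m r≤r′)) r′∸r≤k))
  2+k≤r′ : 2 + k ≤ r′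
  2+k≤r′ = begin
    2 + k         ≡⟨ +-comm 1 (suc k) ⟩
    suc k + 1     ≤⟨ +-mono-≤ k<r′∸r (quot-≥1 M m (≤-trans (s≤s z≤n) s<m) m≤M) ⟩
    (r′ ∸ r) + r  ≡⟨ m∸n+n≡m r≤r′ ⟩
    r′            ∎
    where open ≤-Reasoning

-- A W₁-position (max D, min c ≥ 1) with D ≥ (2 + k)·c has value > k, by the
-- lower bound D < v + 2c: it gives k·c < v, and k ≤ k·c.
large-ratio⇒large-value : ∀ k c D v → 1 ≤ c → (2 + k) * c ≤ D → D < v + 2 * c → k < v
large-ratio⇒large-value k c D v 1≤c ratio bound = ≤-<-trans k≤k*c k*c<v
  where
  k≤k*c : k ≤ k * c
  k≤k*c = subst (_≤ k * c) (*-identityʳ k) (*-monoʳ-≤ k 1≤c)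
  k*c<v : k * c < v
  k*c<v = +-cancelˡ-< (2 * c) (k * c) v (begin-strict
    2 * c + k * c ≡⟨ sym (*-distribʳ-+ c 2 k) ⟩
    (2 + k) * c   ≤⟨ ratio ⟩
    D             <⟨ bound ⟩
    v + 2 * c     ≡⟨ +-comm v (2 * c) ⟩
    2 * c + v     ∎)
    where open ≤-Reasoning

filterB⊆ : ∀ {A : Set} (f : A → Bool) xs → filterB f xs ⊆ xs
filterB⊆ f (y ∷ ys) x∈ with f y
... | false = there (filterB⊆ f ys x∈)
... | true with x∈
...   | here x≡y = here x≡y
...   | there x∈ys = there (filterB⊆ f ys x∈ys)

filterB⁺ : ∀ {A : Set} (f : A → Bool) {x} {xs} → x ∈ xs → f x ≡ true → x ∈ filterB f xs
filterB⁺ f {xs = y ∷ ys} (here refl) fx rewrite fx = here refl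
filterB⁺ f {xs = y ∷ ys} (there x∈) fx with f y
... | true  = there (filterB⁺ f x∈ fx)
... | false = filterB⁺ f x∈ fx

T⊆W₁ : ∀ k p → T k p ⊆ W₁ p
T⊆W₁ k p = ⊆.++⁺ (⊆.⊆-refl {x = nimMoves p})
                  (⊆.map⁺ (diagTarget p) (filterB⊆ (allowedT k p) (diagSteps p)))

forbidden-move-value : ∀ k a b s → s < a ⊓ b → allowedT k (a , b) s ≡ false
                     → k < val W₁ (diagTarget (a , b) s)
forbidden-move-value k a b s s<m forbidden =
  large-ratio⇒large-value k ((a ∸ s) ⊓ (b ∸ s)) ((a ∸ s) ⊔ (b ∸ s)) _ 1≤c
    (subst₂ (λ D c → (2 + k) * c ≤ D) max-eq min-eq
       (ratio-jump k (a ⊔ b) (a ⊓ b) s s<m (m⊓n≤m⊔n a b) jump))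
    (W₁-lower-bound (a ∸ s) (b ∸ s) 1≤c)
  where
  max-eq : a ⊔ b ∸ s ≡ (a ∸ s) ⊔ (b ∸ s)
  max-eq = ∸-distribʳ-⊔ s a b
  min-eq : a ⊓ b ∸ s ≡ (a ∸ s) ⊓ (b ∸ s)
  min-eq = ∸-distribʳ-⊓ s a b
  1≤c : 1 ≤ (a ∸ s) ⊓ (b ∸ s)
  1≤c = subst (1 ≤_) min-eq (m<n⇒0<n∸m s<m)
  jump : ¬ (∣ quot (a ⊔ b ∸ s) (a ⊓ b ∸ s) - ratio (a , b) ∣ ≤ k)
  jump allowed = subst IsTrue forbidden
    (≤⇒≤ᵇ (subst₂ (λ D c → ∣ quot D c - ratio (a , b) ∣ ≤ k) max-eq min-eq allowed))

T-escape : ∀ k p q → q ∈ W₁ p → q ∈ T k p ⊎ k < val W₁ q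
T-escape k (a , b) q q∈ with ∈-++⁻ (nimMoves (a , b)) q∈
... | inj₁ q∈nim = inj₁ (∈-++⁺ˡ q∈nim)
... | inj₂ q∈diag with ∈-map⁻ (diagTarget (a , b)) q∈diag
...   | s , s∈ , refl with allowedT k (a , b) s in allowed
...     | true  = inj₁ (∈-++⁺ʳ (nimMoves (a , b))
                     (∈-map⁺ (diagTarget (a , b)) (filterB⁺ (allowedT k (a , b)) s∈ allowed)))
...     | false = inj₂ (forbidden-move-value k a b s (∈-diagSteps⁻ s∈) allowed)

T-agrees-with-W₁ : ∀ k g → g ≤ k → ∀ a b → (val (T k) (a , b) ≡ g) ⇔ (val W₁ (a , b) ≡ g)
T-agrees-with-W₁ k g g≤k a b =
  Agreement.agree W₁ (T k) W₁-decreasing (T⊆W₁ k) k (T-escape k) (a , b) g g≤k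

theorem8 : ((k g : ℕ) → g ≤ k → (a b : ℕ)
             → (nimValue (T k) a b ≡ g) ⇔ (nimValue W₁ a b ≡ g))
           × ((k l g : ℕ) → g ≤ k → g ≤ l → (a b : ℕ)
             → (nimValue (T k) a b ≡ g) ⇔ (nimValue (T l) a b ≡ g))
theorem8 = T-agrees-with-W₁ , T_k-agrees-with-T_l
  where
  T_k-agrees-with-T_l : ∀ k l g → g ≤ k → g ≤ l → ∀ a b
                      → (val (T k) (a , b) ≡ g) ⇔ (val (T l) (a , b) ≡ g)
  T_k-agrees-with-T_l k l g g≤k g≤l a b =
    ⇔-sym (T-agrees-with-W₁ l g g≤l a b) ⇔-∘ T-agrees-with-W₁ k g g≤k a b
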